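{- Let $v$ be a positive integer and let $L=\{a_1^{m_1},a_2^{m_2},\ldots,a_t^{m_t}\}$ be a list of $k$ elements of $\{1,2,\ldots,\lfloor v/2\rfloor\}$ such that $d=\gcd(v,a_1,a_2,\ldots,a_t)>1$. Then there exists a cycle $C$ of $K_v$ such that $\ell(C)=L$ if and only if there exists a cycle $C'$ of $K_{v/d}$ such that $\ell(C')=\{(a_1/d)^{m_1},(a_2/d)^{m_2},\ldots,(a_t/d)^{m_t}\}$.
   Context: The complete graph $K_n$ has vertex set $\mathbb{Z}_n=\{0,1,\ldots,n-1\}$. The length of an edge $[x,y]$ of $K_n$ is $\ell(x,y)=\min(|x-y|,\,n-|x-y|)$. For a subgraph $\Gamma$ of $K_n$, $\ell(\Gamma)$ is the multiset of the lengths of all edges of $\Gamma$ (with multiplicity). The notation $\{a_1^{m_1},\ldots,a_t^{m_t}\}$ denotes the multiset (list) consisting of $m_i$ copies of $a_i$ for each $i$, with $a_1,\ldots,a_t$ distinct; here $k=m_1+\cdots+m_t$. A cycle with $\ell(C)=L$ thus has exactly $k$ edges (a $k$-cycle, i.e. $k$ distinct vertices $c_1,\ldots,c_k$ with edges $[c_h,c_{h+1}]$, indices mod $k$). -}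

module Defs where

open import Data.Nat using (ℕ; _⊓_; _∸_; ∣_-_∣; _≤_; _<_; _/_; NonZero; >-nonZero)
open import Data.Nat.DivMod
import Data.Nat
import Data.Nat.Properties
open import Data.Nat.GCD using (gcd)
open import Data.Fin using (Fin; toℕ)
open import Data.List using (List; []; _∷_; _++_; [_]; length; foldr; map)
open import Data.List.Relation.Unary.Unique.Propositional using (Unique)
open import Data.List.Relation.Binary.Permutation.Propositional using (_↭_)
open import Data.Product using (Σ; _×_)

ℓ : (n : ℕ) → Fin n → Fin n → ℕ
ℓ n x y = ∣ toℕ x - toℕ y ∣ ⊓ (n ∸ ∣ toℕ x - toℕ y ∣)

pathLengths : (n : ℕ) → List (Fin n) → List ℕ
pathLengths n []            = []
pathLengths n (x ∷ [])      = []
pathLengths n (x ∷ y ∷ xs)  = ℓ n x y ∷ pathLengths n (y ∷ xs)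

cycleLengths : (n : ℕ) → List (Fin n) → List ℕ
cycleLengths n []       = []
cycleLengths n (x ∷ xs) = pathLengths n ((x ∷ xs) ++ [ x ])

IsCycle : (n : ℕ) → List (Fin n) → Set
IsCycle n cs = (3 ≤ length cs) × Unique cs

-- There is a cycle C of K_n with ℓ(C) = L (equality of multisets = permutation)
HasCycleWithLengths : (n : ℕ) → List ℕ → Set
HasCycleWithLengths n L = Σ (List (Fin n)) λ cs → IsCycle n cs × (cycleLengths n cs ↭ L)

gcdList : ℕ → List ℕ → ℕ
gcdList v L = foldr gcd v L

divList : (d : ℕ) → 1 < d → List ℕ → List ℕ
divList d 1<d L = map (λ a → (a / d) {{>-nonZero (Data.Nat.Properties.<-trans (Data.Nat.s≤s Data.Nat.z≤n) 1<d)}}) L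

divBy : (d : ℕ) → 1 < d → ℕ → ℕ
divBy d 1<d v = (v / d) {{>-nonZero (Data.Nat.Properties.<-trans (Data.Nat.s≤s Data.Nat.z≤n) 1<d)}}

module Submission where

-- Write v = d·w and say that a vertex x of K_v lies over the vertex x' of
-- K_w in residue class r when x = r + d·x'.  Two vertices lying over x', y'
-- in the same class are at distance d·|x' - y'| and, since v = d·w, the edge
-- joining them has length d·ℓ_w(x', y').  Lying over is injective both ways,
-- so a vertex list lying over another one is a cycle iff the other one is,
-- and its length list is d times the other one's.
--
-- Backward direction: multiply a cycle of K_w by d (residue class 0).
-- Forward direction: every edge length of the cycle is a multiple of d and
-- d ∣ v, so consecutive vertices, hence all vertices, are congruent mod d;
-- the cycle therefore lies over its image under x ↦ ⌊x/d⌋.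

open import Defs
open import Data.Nat using (ℕ; _≤_; _<_; _/_)
open import Data.List using (List)
open import Data.List.Relation.Unary.All using (All)
open import Data.Product using (_×_)
open import Function.Bundles using (_⇔_)

open import Data.Nat using (_+_; _*_; _∸_; _⊓_; ∣_-_∣; NonZero; >-nonZero; _%_; z≤n; s≤s)
open import Data.Nat.Properties
open import Data.Nat.DivMod using (m*n/n≡m; m*[n/m]≡n; [m+kn]%n≡m%n; m≡m%n+[m/n]*n; m<n*o⇒m/o<n)
open import Data.Nat.Divisibility using (_∣_; divides; ∣-refl; ∣-trans; ∣m+n∣m⇒∣n)
open import Data.Nat.GCD using (gcd[m,n]∣m; gcd[m,n]∣n)
open import Data.Fin using (Fin; toℕ; fromℕ<)
open import Data.Fin.Properties using (toℕ-fromℕ<; toℕ-injective; toℕ<n)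
open import Data.List using ([]; _∷_; _++_; [_]; map)
open import Data.List.Relation.Unary.All using ([]; _∷_)
import Data.List.Relation.Unary.All as All
open import Data.List.Relation.Unary.All.Properties using (++⁻ˡ)
open import Data.List.Relation.Unary.AllPairs using ([]; _∷_)
open import Data.List.Relation.Unary.Unique.Propositional using (Unique)
open import Data.List.Relation.Binary.Pointwise using (Pointwise; []; _∷_; ++⁺)
open import Data.List.Relation.Binary.Pointwise.Properties using (Pointwise-length; symmetric)
open import Data.List.Relation.Binary.Permutation.Propositional using (_↭_; ↭-sym)
open import Data.List.Relation.Binary.Permutation.Propositional.Properties using (All-resp-↭)
import Data.List.Relation.Binary.Permutation.Propositional.Properties as Perm
open import Data.Product using (_,_)
open import Data.Sum using (inj₁; inj₂; [_,_]′)
open import Function.Bundles using (mk⇔; Equivalence)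
open import Relation.Binary.PropositionalEquality hiding ([_])
open import Relation.Nullary using (¬_)

gcdList∣v : ∀ v L → gcdList v L ∣ v
gcdList∣v v []      = ∣-refl
gcdList∣v v (a ∷ L) = ∣-trans (gcd[m,n]∣n a (gcdList v L)) (gcdList∣v v L)

gcdList∣elements : ∀ v L → All (gcdList v L ∣_) L
gcdList∣elements v []      = []
gcdList∣elements v (a ∷ L) =
  gcd[m,n]∣m a _ ∷ All.map (∣-trans (gcd[m,n]∣n a (gcdList v L))) (gcdList∣elements v L)

∣diff⇒≡mod : ∀ d .{{_ : NonZero d}} {m n} → m ≤ n → d ∣ n ∸ m → n % d ≡ m % d
∣diff⇒≡mod d {m} {n} m≤n (divides q n∸m≡qd) = begin
  n % d                ≡⟨ cong (_% d) (m+[n∸m]≡n m≤n) ⟨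
  (m + (n ∸ m)) % d    ≡⟨ cong (λ k → (m + k) % d) n∸m≡qd ⟩
  (m + q * d) % d      ≡⟨ [m+kn]%n≡m%n m q d ⟩
  m % d                ∎
  where open ≡-Reasoning

∣dist⇒≡mod : ∀ d .{{_ : NonZero d}} m n → d ∣ ∣ m - n ∣ → m % d ≡ n % d
∣dist⇒≡mod d m n d∣dist with ≤-total m n
... | inj₁ m≤n = sym (∣diff⇒≡mod d m≤n (subst (d ∣_) (m≤n⇒∣m-n∣≡n∸m m≤n) d∣dist))
... | inj₂ n≤m = ∣diff⇒≡mod d n≤m (subst (d ∣_) (m≤n⇒∣n-m∣≡n∸m n≤m) d∣dist)

-- In K_v with d ∣ v, an edge whose length is a multiple of d joins
-- vertices whose distance |x - y| is a multiple of d: the length is either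
-- |x - y| or v - |x - y|.

∣ℓ⇒∣dist : ∀ {d v} (x y : Fin v) → d ∣ v → d ∣ ℓ v x y → d ∣ ∣ toℕ x - toℕ y ∣
∣ℓ⇒∣dist {d} {v} x y d∣v d∣ℓ = [ short , long ]′ (⊓-sel dist (v ∸ dist))
  where
  dist : ℕ
  dist = ∣ toℕ x - toℕ y ∣
  dist≤v : dist ≤ v
  dist≤v = ≤-trans (∣m-n∣≤m⊔n (toℕ x) (toℕ y)) (⊔-lub (<⇒≤ (toℕ<n x)) (<⇒≤ (toℕ<n y)))
  short : ℓ v x y ≡ dist → d ∣ dist
  short ℓ≡dist = subst (d ∣_) ℓ≡dist d∣ℓ
  long : ℓ v x y ≡ v ∸ dist → d ∣ dist
  long ℓ≡v∸dist = ∣m+n∣m⇒∣n (subst (d ∣_) (sym (m∸n+n≡m dist≤v)) d∣v) (subst (d ∣_) ℓ≡v∸dist d∣ℓ)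

pathResidue : ∀ {d v} .{{_ : NonZero d}} → d ∣ v → (y : Fin v) (ys : List (Fin v)) →
  All (d ∣_) (pathLengths v (y ∷ ys)) → All (λ z → toℕ z % d ≡ toℕ y % d) (y ∷ ys)
pathResidue d∣v y []        _            = refl ∷ []
pathResidue {d} d∣v y (z ∷ ys) (d∣ℓ ∷ d∣ℓs) =
  refl ∷ All.map (λ ≡z → trans ≡z (sym y≡z)) (pathResidue d∣v z ys d∣ℓs)
  where
  y≡z : toℕ y % d ≡ toℕ z % d
  y≡z = ∣dist⇒≡mod d (toℕ y) (toℕ z) (∣ℓ⇒∣dist y z d∣v d∣ℓ)

Unique-transport : ∀ {A B : Set} {R : A → B → Set} →
  (∀ {x x' y y'} → R x x' → R y y' → x' ≡ y' → x ≡ y) →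
  ∀ {xs ys} → Pointwise R xs ys → Unique xs → Unique ys
Unique-transport inj [] [] = []
Unique-transport {R = R} inj (x∼x' ∷ xs∼ys) (x∉xs ∷ uniq) =
  fresh x∼x' xs∼ys x∉xs ∷ Unique-transport inj xs∼ys uniq
  where
  fresh : ∀ {x x' zs zs'} → R x x' → Pointwise R zs zs' →
    All (λ z → ¬ x ≡ z) zs → All (λ z' → ¬ x' ≡ z') zs'
  fresh x∼x' []             []           = []
  fresh x∼x' (z∼z' ∷ zs∼zs') (x≢z ∷ x≢zs) =
    (λ x'≡z' → x≢z (inj x∼x' z∼z' x'≡z')) ∷ fresh x∼x' zs∼zs' x≢zs

LiesOver : ∀ {v w} (d r : ℕ) → Fin v → Fin w → Set
LiesOver d r x x' = toℕ x ≡ r + d * toℕ x'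

module _ {v w d r : ℕ} .{{_ : NonZero d}} where

  liesOver-injective : ∀ {x y : Fin v} {x' y' : Fin w} →
    LiesOver d r x x' → LiesOver d r y y' → x' ≡ y' → x ≡ y
  liesOver-injective x∼x' y∼y' refl = toℕ-injective (trans x∼x' (sym y∼y'))

  liesOver-functional : ∀ {x y : Fin v} {x' y' : Fin w} →
    LiesOver d r x x' → LiesOver d r y y' → x ≡ y → x' ≡ y'
  liesOver-functional {x' = x'} {y'} x∼x' y∼y' refl =
    toℕ-injective (*-cancelˡ-≡ (toℕ x') (toℕ y') d (+-cancelˡ-≡ r _ _ (trans (sym x∼x') y∼y')))

  isCycle-over : ∀ {cs cs'} → Pointwise (LiesOver d r) cs cs' → IsCycle v cs ⇔ IsCycle w cs'
  isCycle-over cs∼cs' = mk⇔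
    (λ (3≤ , uniq) → subst (3 ≤_) (Pointwise-length cs∼cs') 3≤ ,
                     Unique-transport liesOver-injective cs∼cs' uniq)
    (λ (3≤ , uniq) → subst (3 ≤_) (sym (Pointwise-length cs∼cs')) 3≤ ,
                     Unique-transport liesOver-functional (symmetric (λ p → p) cs∼cs') uniq)

module Scaling (v d w : ℕ) .{{_ : NonZero d}} (v≡dw : v ≡ d * w) where

  ℓ-over : ∀ {r} {x y : Fin v} {x' y' : Fin w} →
    LiesOver d r x x' → LiesOver d r y y' → ℓ v x y ≡ d * ℓ w x' y'
  ℓ-over {r} {x} {y} {x'} {y'} x∼x' y∼y' = begin
      dist ⊓ (v ∸ dist)                 ≡⟨ cong (λ k → k ⊓ (v ∸ k)) dist≡ ⟩
      (d * dist') ⊓ (v ∸ d * dist')     ≡⟨ cong (λ u → (d * dist') ⊓ (u ∸ d * dist')) v≡dw ⟩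
      (d * dist') ⊓ (d * w ∸ d * dist') ≡⟨ cong ((d * dist') ⊓_) (*-distribˡ-∸ d w dist') ⟨
      (d * dist') ⊓ (d * (w ∸ dist'))   ≡⟨ *-distribˡ-⊓ d dist' (w ∸ dist') ⟨
      d * (dist' ⊓ (w ∸ dist'))         ∎
    where
    open ≡-Reasoning
    dist dist' : ℕ
    dist  = ∣ toℕ x - toℕ y ∣
    dist' = ∣ toℕ x' - toℕ y' ∣
    dist≡ : dist ≡ d * dist'
    dist≡ = begin
      dist                                    ≡⟨ cong₂ ∣_-_∣ x∼x' y∼y' ⟩
      ∣ r + d * toℕ x' - r + d * toℕ y' ∣     ≡⟨ ∣m+n-m+o∣≡∣n-o∣ r _ _ ⟩
      ∣ d * toℕ x' - d * toℕ y' ∣             ≡⟨ *-distribˡ-∣-∣ d (toℕ x') (toℕ y') ⟨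
      d * dist'                               ∎

  pathLengths-over : ∀ {r cs cs'} → Pointwise (LiesOver d r) cs cs' →
    pathLengths v cs ≡ map (d *_) (pathLengths w cs')
  pathLengths-over []                    = refl
  pathLengths-over (_ ∷ [])              = refl
  pathLengths-over (x∼x' ∷ y∼y' ∷ cs∼cs') =
    cong₂ _∷_ (ℓ-over x∼x' y∼y') (pathLengths-over (y∼y' ∷ cs∼cs'))

  cycleLengths-over : ∀ {r cs cs'} → Pointwise (LiesOver d r) cs cs' →
    cycleLengths v cs ≡ map (d *_) (cycleLengths w cs')
  cycleLengths-over []               = refl
  cycleLengths-over (x∼x' ∷ cs∼cs') = pathLengths-over (++⁺ (x∼x' ∷ cs∼cs') (x∼x' ∷ []))

  divide-multiply : ∀ X → map (_/ d) (map (d *_) X) ≡ X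
  divide-multiply []      = refl
  divide-multiply (a ∷ X) = cong₂ _∷_ (trans (cong (_/ d) (*-comm d a)) (m*n/n≡m a d)) (divide-multiply X)

  multiply-divide : ∀ {X} → All (d ∣_) X → map (d *_) (map (_/ d) X) ≡ X
  multiply-divide []          = refl
  multiply-divide (d∣a ∷ d∣X) = cong₂ _∷_ (m*[n/m]≡n d∣a) (multiply-divide d∣X)

  lengths-over : ∀ {r cs cs' L} → All (d ∣_) L → Pointwise (LiesOver d r) cs cs' →
    (cycleLengths v cs ↭ L) ⇔ (cycleLengths w cs' ↭ map (_/ d) L)
  lengths-over {cs = cs} {cs'} {L} d∣L cs∼cs' = mk⇔
    (λ perm → subst (_↭ map (_/ d) L) lengths'≡ (Perm.map⁺ (_/ d) perm))
    (λ perm → subst₂ _↭_ (sym (cycleLengths-over cs∼cs')) (multiply-divide d∣L) (Perm.map⁺ (d *_) perm))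
    where
    lengths'≡ : map (_/ d) (cycleLengths v cs) ≡ cycleLengths w cs'
    lengths'≡ = trans (cong (map (_/ d)) (cycleLengths-over cs∼cs')) (divide-multiply _)

  multiply : Fin w → Fin v
  multiply x' = fromℕ< (subst (d * toℕ x' <_) (sym v≡dw) (*-monoʳ-< d (toℕ<n x')))

  multiply-over : ∀ cs' → Pointwise (LiesOver d 0) (map multiply cs') cs'
  multiply-over []        = []
  multiply-over (x' ∷ cs') = toℕ-fromℕ< _ ∷ multiply-over cs'

  divide : Fin v → Fin w
  divide x = fromℕ< (m<n*o⇒m/o<n (subst (toℕ x <_) (trans v≡dw (*-comm d w)) (toℕ<n x)))

  divide-over : ∀ {r} cs → All (λ x → toℕ x % d ≡ r) cs → Pointwise (LiesOver d r) cs (map divide cs)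
  divide-over          []       []              = []
  divide-over {r} (x ∷ cs) (x%d≡r ∷ cs%d≡r) = x∼divide ∷ divide-over cs cs%d≡r
    where
    open ≡-Reasoning
    x∼divide : LiesOver d r x (divide x)
    x∼divide = begin
      toℕ x                       ≡⟨ m≡m%n+[m/n]*n (toℕ x) d ⟩
      toℕ x % d + toℕ x / d * d   ≡⟨ cong₂ _+_ x%d≡r (*-comm (toℕ x / d) d) ⟩
      r + d * (toℕ x / d)         ≡⟨ cong (λ k → r + d * k) (toℕ-fromℕ< _) ⟨
      r + d * toℕ (divide x)      ∎

  cycle-reduction : ∀ L → All (d ∣_) L →
    HasCycleWithLengths v L ⇔ HasCycleWithLengths w (map (_/ d) L)
  cycle-reduction L d∣L = mk⇔ reduce expand
    where
    d∣v : d ∣ v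
    d∣v = divides w (trans v≡dw (*-comm d w))

    reduce : HasCycleWithLengths v L → HasCycleWithLengths w (map (_/ d) L)
    reduce ([]           , (() , _) , _)
    reduce (cs@(x ∷ xs) , cyc , perm) =
      map divide cs , Equivalence.to (isCycle-over cs∼cs') cyc , Equivalence.to (lengths-over d∣L cs∼cs') perm
      where
      congruent : All (λ z → toℕ z % d ≡ toℕ x % d) cs
      congruent = ++⁻ˡ cs (pathResidue d∣v x (xs ++ [ x ]) (All-resp-↭ (↭-sym perm) d∣L))
      cs∼cs' : Pointwise (LiesOver d (toℕ x % d)) cs (map divide cs)
      cs∼cs' = divide-over cs congruent

    expand : HasCycleWithLengths w (map (_/ d) L) → HasCycleWithLengths v L
    expand (cs' , cyc , perm) =
      map multiply cs' , Equivalence.from (isCycle-over cs∼cs') cyc , Equivalence.from (lengths-over d∣L cs∼cs') perm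
      where
      cs∼cs' : Pointwise (LiesOver d 0) (map multiply cs') cs'
      cs∼cs' = multiply-over cs'

-- Lemma 3.4: instantiate the reduction with d = gcd(v, a₁, …, aₜ).

lemma3p4 : (v : ℕ) → 1 ≤ v → (L : List ℕ) →
    All (λ a → (1 ≤ a) × (a ≤ v / 2)) L →
    (1<d : 1 < gcdList v L) →
    HasCycleWithLengths v L ⇔
    HasCycleWithLengths (divBy (gcdList v L) 1<d v) (divList (gcdList v L) 1<d L)
lemma3p4 v _ L _ 1<d = Scaling.cycle-reduction v d (v / d) v≡d[v/d] L (gcdList∣elements v L)
  where
  d : ℕ
  d = gcdList v L
  instance
    d≢0 : NonZero d
    d≢0 = >-nonZero (<-trans (s≤s z≤n) 1<d)
  v≡d[v/d] : v ≡ d * (v / d)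
  v≡d[v/d] = sym (m*[n/m]≡n (gcdList∣v v L))
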